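{- For all (possibly open) terms $t_0,t_1$ of $\lambda_S$: $t_0\cong^\circ t_1$ if and only if for every context $C$ binding all free variables of $t_0$ and $t_1$ (so that $C[t_0]$ and $C[t_1]$ are closed), (a) $C[t_0]\Downarrow v_0$ for some value $v_0$ iff $C[t_1]\Downarrow v_1$ for some value $v_1$, and (b) $C[t_0]\Downarrow t_0'$ for some control-stuck term $t_0'$ iff $C[t_1]\Downarrow t_1'$ for some control-stuck term $t_1'$.
   Context: The calculus $\lambda_S$: terms $t ::= v \mid t\,t \mid \mathcal{S}k.t \mid \langle t\rangle$, values $v ::= x \mid \lambda x.t$. Pure contexts $E ::= \square \mid v\,E \mid E\,t$; evaluation contexts $F ::= \square \mid v\,F \mid F\,t \mid \langle F\rangle$; contexts $C ::= \square \mid \lambda x.C \mid t\,C \mid C\,t \mid \mathcal{S}k.C \mid \langle C\rangle$ (plugging may capture free variables). Reduction: $F[(\lambda x.t)\,v] \to F[t\{v/x\}]$; $F[\langle E[\mathcal{S}k.t]\rangle] \to F[\langle t\{\lambda x.\langle E[x]\rangle/k\}\rangle]$ ($x\notin\mathrm{fv}(E)$); $F[\langle v\rangle]\to F[v]$. Normal form: value or non-value that does not reduce; control-stuck term: $E[\mathcal{S}k.t]$; $t\Downarrow t'$: $t\to^* t'$ with $t'$ normal form. For closed terms, $t_0\cong t_1$ iff for every closed context $C$, $C[t_0]$ evaluates to a value iff $C[t_1]$ does, and $C[t_0]$ evaluates to a control-stuck term iff $C[t_1]$ does. Open extension: $t_0\cong^\circ t_1$ iff $t_0\sigma\cong t_1\sigma$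 for every substitution $\sigma$ mapping the free variables of $t_0$ and $t_1$ to closed values. -}

module Defs where

open import Data.Nat using (ℕ; zero; suc)
open import Data.Fin using (Fin; zero; suc)
open import Data.Product using (∃; _×_; _,_)
open import Data.Sum using (_⊎_)
open import Relation.Nullary using (¬_)
open import Relation.Binary.PropositionalEquality using (_≡_)
open import Relation.Binary.Construct.Closure.ReflexiveTransitive using (Star)
open import Function.Bundles using (_⇔_)

mutual
  data Tm (n : ℕ) : Set where
    val   : Val n → Tm n
    app   : Tm n → Tm n → Tm n
    shift : Tm (suc n) → Tm n      -- S k. t   (k is de Bruijn index 0)
    reset : Tm n → Tm n

  data Val (n : ℕ) : Set where
    var : Fin n → Val n
    lam : Tm (suc n) → Val n

IsValue : ∀ {n} → Tm n → Set
IsValue {n} t = ∃ λ (v : Val n) → t ≡ val v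

Ren : ℕ → ℕ → Set
Ren n m = Fin n → Fin m

extR : ∀ {n m} → Ren n m → Ren (suc n) (suc m)
extR ρ zero    = zero
extR ρ (suc i) = suc (ρ i)

mutual
  ren : ∀ {n m} → Ren n m → Tm n → Tm m
  ren ρ (val v)     = val (renV ρ v)
  ren ρ (app t u)   = app (ren ρ t) (ren ρ u)
  ren ρ (shift t)   = shift (ren (extR ρ) t)
  ren ρ (reset t)   = reset (ren ρ t)

  renV : ∀ {n m} → Ren n m → Val n → Val m
  renV ρ (var i) = var (ρ i)
  renV ρ (lam t) = lam (ren (extR ρ) t)

Sub : ℕ → ℕ → Set
Sub n m = Fin n → Val m

extS : ∀ {n m} → Sub n m → Sub (suc n) (suc m)
extS σ zero    = var zero
extS σ (suc i) = renV suc (σ i)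

mutual
  sub : ∀ {n m} → Sub n m → Tm n → Tm m
  sub σ (val v)     = val (subV σ v)
  sub σ (app t u)   = app (sub σ t) (sub σ u)
  sub σ (shift t)   = shift (sub (extS σ) t)
  sub σ (reset t)   = reset (sub σ t)

  subV : ∀ {n m} → Sub n m → Val n → Val m
  subV σ (var i) = σ i
  subV σ (lam t) = lam (sub (extS σ) t)

single : ∀ {n} → Val n → Sub (suc n) n
single v zero    = v
single v (suc i) = var i

_[_] : ∀ {n} → Tm (suc n) → Val n → Tm n
t [ v ] = sub (single v) t

data ECtx (n : ℕ) : Set where
  hole : ECtx n
  appR : Val n → ECtx n → ECtx n
  appL : ECtx n → Tm n → ECtx n

plugE : ∀ {n} → ECtx n → Tm n → Tm n
plugE hole       s = s
plugE (appR v E) s = app (val v) (plugE E s)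
plugE (appL E t) s = app (plugE E s) t

renE : ∀ {n m} → Ren n m → ECtx n → ECtx m
renE ρ hole       = hole
renE ρ (appR v E) = appR (renV ρ v) (renE ρ E)
renE ρ (appL E t) = appL (renE ρ E) (ren ρ t)

data FCtx (n : ℕ) : Set where
  hole  : FCtx n
  appR  : Val n → FCtx n → FCtx n
  appL  : FCtx n → Tm n → FCtx n
  reset : FCtx n → FCtx n

plugF : ∀ {n} → FCtx n → Tm n → Tm n
plugF hole       s = s
plugF (appR v F) s = app (val v) (plugF F s)
plugF (appL F t) s = app (plugF F s) t
plugF (reset F)  s = reset (plugF F s)

-- General contexts C (plugging captures variables).
-- Ctx m k : the hole expects a term in scope m, the result is in scope k.
data Ctx (m : ℕ) : ℕ → Set where
  hole  : Ctx m m
  lam   : ∀ {k} → Ctx m (suc k) → Ctx m k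
  appR  : ∀ {k} → Tm k → Ctx m k → Ctx m k
  appL  : ∀ {k} → Ctx m k → Tm k → Ctx m k
  shift : ∀ {k} → Ctx m (suc k) → Ctx m k
  reset : ∀ {k} → Ctx m k → Ctx m k

plug : ∀ {m k} → Ctx m k → Tm m → Tm k
plug hole       s = s
plug (lam C)    s = val (lam (plug C s))
plug (appR t C) s = app t (plug C s)
plug (appL C t) s = app (plug C s) t
plug (shift C)  s = shift (plug C s)
plug (reset C)  s = reset (plug C s)

-- the captured continuation λx.⟨E[x]⟩  (x fresh for E by weakening)
cont : ∀ {n} → ECtx n → Val n
cont E = lam (reset (plugE (renE suc E) (val (var zero))))

data _⟶_ {n : ℕ} : Tm n → Tm n → Set where
  βv    : (F : FCtx n) (t : Tm (suc n)) (v : Val n) →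
          plugF F (app (val (lam t)) (val v)) ⟶ plugF F (t [ v ])
  shift : (F : FCtx n) (E : ECtx n) (t : Tm (suc n)) →
          plugF F (reset (plugE E (shift t))) ⟶ plugF F (reset (t [ cont E ]))
  reset : (F : FCtx n) (v : Val n) →
          plugF F (reset (val v)) ⟶ plugF F (val v)

_⟶*_ : ∀ {n} → Tm n → Tm n → Set
_⟶*_ = Star _⟶_

Reducible : ∀ {n} → Tm n → Set
Reducible t = ∃ λ t' → t ⟶ t'

NormalForm : ∀ {n} → Tm n → Set
NormalForm t = IsValue t ⊎ (¬ IsValue t × ¬ Reducible t)

ControlStuck : ∀ {n} → Tm n → Set
ControlStuck {n} t = ∃ λ (E : ECtx n) → ∃ λ (s : Tm (suc n)) → t ≡ plugE E (shift s)

_⇓_ : ∀ {n} → Tm n → Tm n → Set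
t ⇓ t' = (t ⟶* t') × NormalForm t'

EvalsToValue : ∀ {n} → Tm n → Set
EvalsToValue t = ∃ λ t' → (t ⇓ t') × IsValue t'

EvalsToStuck : ∀ {n} → Tm n → Set
EvalsToStuck t = ∃ λ t' → (t ⇓ t') × ControlStuck t'

ObsAgree : Tm 0 → Tm 0 → Set
ObsAgree t u = (EvalsToValue t ⇔ EvalsToValue u) × (EvalsToStuck t ⇔ EvalsToStuck u)

_≅_ : Tm 0 → Tm 0 → Set
t₀ ≅ t₁ = (C : Ctx 0 0) → ObsAgree (plug C t₀) (plug C t₁)

_≅°_ : ∀ {n} → Tm n → Tm n → Set
_≅°_ {n} t₀ t₁ = (σ : Sub n 0) → sub σ t₀ ≅ sub σ t₁

mutual
  data _∈fv_ {n : ℕ} : Fin n → Tm n → Set where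
    val   : ∀ {i v} → i ∈fvV v → i ∈fv val v
    appL  : ∀ {i t u} → i ∈fv t → i ∈fv app t u
    appR  : ∀ {i t u} → i ∈fv u → i ∈fv app t u
    shift : ∀ {i t} → suc i ∈fv t → i ∈fv shift t
    reset : ∀ {i t} → i ∈fv t → i ∈fv reset t

  data _∈fvV_ {n : ℕ} : Fin n → Val n → Set where
    var : ∀ {i} → i ∈fvV var i
    lam : ∀ {i t} → suc i ∈fv t → i ∈fvV lam t

-- A closing context for t₀,t₁ in the named sense is represented by a
-- context C : Ctx m 0 together with the assignment ρ of each free
-- variable of t₀,t₁ to the binder (of C) capturing it; distinct free
-- variables are captured by distinct binders.
InjOnFV : ∀ {n m} → Ren n m → Tm n → Tm n → Set
InjOnFV ρ t₀ t₁ = ∀ i j → (i ∈fv t₀ ⊎ i ∈fv t₁) → (j ∈fv t₀ ⊎ j ∈fv t₁) →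
                  ρ i ≡ ρ j → i ≡ j

-- (⇐) Take ρ the identity. For closed values σ and a closed context C, the context
-- D = (λ.⋯(λ.C[□]) (σ 0)⋯) (σ (n-1)) binds every variable and D[t] reduces at top level to
-- C[tσ]; reduction is deterministic, so this does not change whether a value or a stuck
-- term is reached.
-- (⇒) Relate C[t₀ρ] and C[t₁ρ] by the least compatible relation ~ containing all pairs
-- (t₀τ, t₁τ') with τ ~ τ' pointwise; it is closed under substitution, hence under
-- contraction. An instance of the base pair that is not under a binder is closed, so by
-- t₀ ≅° t₁ it may be replaced by t₀τ' on the right, up to ≅. The two sides then have the
-- same redex and the same value/stuck shape, and a reduction of the left side is matched
-- step by step on the right.

module Submission where

open import Defs
open import Data.Nat using (ℕ; zero; suc; _≤_)
open import Data.Nat.Properties using (≤-refl; ≤-trans; n≤1+n; n≮0)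
open import Data.Fin using (Fin; zero; suc)
open import Data.Empty using (⊥-elim)
open import Data.Product using (∃-syntax; _×_; _,_; proj₁; proj₂)
open import Data.Sum using (inj₁; inj₂)
open import Function using (_∘_; id)
open import Function.Bundles using (_⇔_; mk⇔; Equivalence)
open import Function.Properties.Equivalence using (⇔-isEquivalence)
open import Relation.Binary.Structures using (IsEquivalence)
open import Relation.Binary.PropositionalEquality hiding ([_])
open import Relation.Binary.Construct.Closure.ReflexiveTransitive using (ε; _◅_; _◅◅_)
open import Relation.Binary.Rewriting using (Deterministic; det⇒conf)
open import Relation.Nullary using (¬_)
import Level

extR-cong : ∀ {n m} {ρ ρ' : Ren n m} → ρ ≗ ρ' → extR ρ ≗ extR ρ'
extR-cong e zero    = refl
extR-cong e (suc i) = cong suc (e i)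

mutual
  ren-cong : ∀ {n m} {ρ ρ' : Ren n m} → ρ ≗ ρ' → (t : Tm n) → ren ρ t ≡ ren ρ' t
  ren-cong e (val v)   = cong val (renV-cong e v)
  ren-cong e (app t u) = cong₂ app (ren-cong e t) (ren-cong e u)
  ren-cong e (shift t) = cong shift (ren-cong (extR-cong e) t)
  ren-cong e (reset t) = cong reset (ren-cong e t)

  renV-cong : ∀ {n m} {ρ ρ' : Ren n m} → ρ ≗ ρ' → (v : Val n) → renV ρ v ≡ renV ρ' v
  renV-cong e (var i) = cong var (e i)
  renV-cong e (lam t) = cong lam (ren-cong (extR-cong e) t)

extS-cong : ∀ {n m} {σ σ' : Sub n m} → σ ≗ σ' → extS σ ≗ extS σ'
extS-cong e zero    = refl
extS-cong e (suc i) = cong (renV suc) (e i)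

mutual
  sub-cong : ∀ {n m} {σ σ' : Sub n m} → σ ≗ σ' → (t : Tm n) → sub σ t ≡ sub σ' t
  sub-cong e (val v)   = cong val (subV-cong e v)
  sub-cong e (app t u) = cong₂ app (sub-cong e t) (sub-cong e u)
  sub-cong e (shift t) = cong shift (sub-cong (extS-cong e) t)
  sub-cong e (reset t) = cong reset (sub-cong e t)

  subV-cong : ∀ {n m} {σ σ' : Sub n m} → σ ≗ σ' → (v : Val n) → subV σ v ≡ subV σ' v
  subV-cong e (var i) = e i
  subV-cong e (lam t) = cong lam (sub-cong (extS-cong e) t)

extR-∘ : ∀ {n m k} (ρ : Ren n m) (ρ' : Ren m k) → extR ρ' ∘ extR ρ ≗ extR (ρ' ∘ ρ)
extR-∘ ρ ρ' zero    = refl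
extR-∘ ρ ρ' (suc i) = refl

mutual
  ren-ren : ∀ {n m k} (ρ : Ren n m) (ρ' : Ren m k) (t : Tm n) →
            ren ρ' (ren ρ t) ≡ ren (ρ' ∘ ρ) t
  ren-ren ρ ρ' (val v)   = cong val (renV-renV ρ ρ' v)
  ren-ren ρ ρ' (app t u) = cong₂ app (ren-ren ρ ρ' t) (ren-ren ρ ρ' u)
  ren-ren ρ ρ' (shift t) =
    cong shift (trans (ren-ren (extR ρ) (extR ρ') t) (ren-cong (extR-∘ ρ ρ') t))
  ren-ren ρ ρ' (reset t) = cong reset (ren-ren ρ ρ' t)

  renV-renV : ∀ {n m k} (ρ : Ren n m) (ρ' : Ren m k) (v : Val n) →
              renV ρ' (renV ρ v) ≡ renV (ρ' ∘ ρ) v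
  renV-renV ρ ρ' (var i) = refl
  renV-renV ρ ρ' (lam t) =
    cong lam (trans (ren-ren (extR ρ) (extR ρ') t) (ren-cong (extR-∘ ρ ρ') t))

extS-extR : ∀ {n m k} (ρ : Ren n m) (σ : Sub m k) → extS σ ∘ extR ρ ≗ extS (σ ∘ ρ)
extS-extR ρ σ zero    = refl
extS-extR ρ σ (suc i) = refl

mutual
  sub-ren : ∀ {n m k} (ρ : Ren n m) (σ : Sub m k) (t : Tm n) →
            sub σ (ren ρ t) ≡ sub (σ ∘ ρ) t
  sub-ren ρ σ (val v)   = cong val (subV-renV ρ σ v)
  sub-ren ρ σ (app t u) = cong₂ app (sub-ren ρ σ t) (sub-ren ρ σ u)
  sub-ren ρ σ (shift t) =
    cong shift (trans (sub-ren (extR ρ) (extS σ) t) (sub-cong (extS-extR ρ σ) t))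
  sub-ren ρ σ (reset t) = cong reset (sub-ren ρ σ t)

  subV-renV : ∀ {n m k} (ρ : Ren n m) (σ : Sub m k) (v : Val n) →
              subV σ (renV ρ v) ≡ subV (σ ∘ ρ) v
  subV-renV ρ σ (var i) = refl
  subV-renV ρ σ (lam t) =
    cong lam (trans (sub-ren (extR ρ) (extS σ) t) (sub-cong (extS-extR ρ σ) t))

renV-extR-extS : ∀ {n m k} (σ : Sub n m) (ρ : Ren m k) →
                 renV (extR ρ) ∘ extS σ ≗ extS (renV ρ ∘ σ)
renV-extR-extS σ ρ zero    = refl
renV-extR-extS σ ρ (suc i) = trans (renV-renV suc (extR ρ) (σ i)) (sym (renV-renV ρ suc (σ i)))

mutual
  ren-sub : ∀ {n m k} (σ : Sub n m) (ρ : Ren m k) (t : Tm n) →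
            ren ρ (sub σ t) ≡ sub (renV ρ ∘ σ) t
  ren-sub σ ρ (val v)   = cong val (renV-subV σ ρ v)
  ren-sub σ ρ (app t u) = cong₂ app (ren-sub σ ρ t) (ren-sub σ ρ u)
  ren-sub σ ρ (shift t) =
    cong shift (trans (ren-sub (extS σ) (extR ρ) t) (sub-cong (renV-extR-extS σ ρ) t))
  ren-sub σ ρ (reset t) = cong reset (ren-sub σ ρ t)

  renV-subV : ∀ {n m k} (σ : Sub n m) (ρ : Ren m k) (v : Val n) →
              renV ρ (subV σ v) ≡ subV (renV ρ ∘ σ) v
  renV-subV σ ρ (var i) = refl
  renV-subV σ ρ (lam t) =
    cong lam (trans (ren-sub (extS σ) (extR ρ) t) (sub-cong (renV-extR-extS σ ρ) t))

subV-extS-extS : ∀ {n m k} (σ : Sub n m) (τ : Sub m k) →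
                 subV (extS τ) ∘ extS σ ≗ extS (subV τ ∘ σ)
subV-extS-extS σ τ zero    = refl
subV-extS-extS σ τ (suc i) = trans (subV-renV suc (extS τ) (σ i)) (sym (renV-subV τ suc (σ i)))

mutual
  sub-sub : ∀ {n m k} (σ : Sub n m) (τ : Sub m k) (t : Tm n) →
            sub τ (sub σ t) ≡ sub (subV τ ∘ σ) t
  sub-sub σ τ (val v)   = cong val (subV-subV σ τ v)
  sub-sub σ τ (app t u) = cong₂ app (sub-sub σ τ t) (sub-sub σ τ u)
  sub-sub σ τ (shift t) =
    cong shift (trans (sub-sub (extS σ) (extS τ) t) (sub-cong (subV-extS-extS σ τ) t))
  sub-sub σ τ (reset t) = cong reset (sub-sub σ τ t)

  subV-subV : ∀ {n m k} (σ : Sub n m) (τ : Sub m k) (v : Val n) →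
              subV τ (subV σ v) ≡ subV (subV τ ∘ σ) v
  subV-subV σ τ (var i) = refl
  subV-subV σ τ (lam t) =
    cong lam (trans (sub-sub (extS σ) (extS τ) t) (sub-cong (subV-extS-extS σ τ) t))

extS-id : ∀ {n} {σ : Sub n n} → σ ≗ var → extS σ ≗ var
extS-id e zero    = refl
extS-id e (suc i) = cong (renV suc) (e i)

mutual
  sub-id : ∀ {n} {σ : Sub n n} → σ ≗ var → (t : Tm n) → sub σ t ≡ t
  sub-id e (val v)   = cong val (subV-id e v)
  sub-id e (app t u) = cong₂ app (sub-id e t) (sub-id e u)
  sub-id e (shift t) = cong shift (sub-id (extS-id e) t)
  sub-id e (reset t) = cong reset (sub-id e t)

  subV-id : ∀ {n} {σ : Sub n n} → σ ≗ var → (v : Val n) → subV σ v ≡ v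
  subV-id e (var i) = e i
  subV-id e (lam t) = cong lam (sub-id (extS-id e) t)

var-extR : ∀ {n m} (ρ : Ren n m) → var ∘ extR ρ ≗ extS (var ∘ ρ)
var-extR ρ zero    = refl
var-extR ρ (suc i) = refl

mutual
  ren≡sub-var : ∀ {n m} (ρ : Ren n m) (t : Tm n) → ren ρ t ≡ sub (var ∘ ρ) t
  ren≡sub-var ρ (val v)   = cong val (renV≡subV-var ρ v)
  ren≡sub-var ρ (app t u) = cong₂ app (ren≡sub-var ρ t) (ren≡sub-var ρ u)
  ren≡sub-var ρ (shift t) =
    cong shift (trans (ren≡sub-var (extR ρ) t) (sub-cong (var-extR ρ) t))
  ren≡sub-var ρ (reset t) = cong reset (ren≡sub-var ρ t)

  renV≡subV-var : ∀ {n m} (ρ : Ren n m) (v : Val n) → renV ρ v ≡ subV (var ∘ ρ) v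
  renV≡subV-var ρ (var i) = refl
  renV≡subV-var ρ (lam t) =
    cong lam (trans (ren≡sub-var (extR ρ) t) (sub-cong (var-extR ρ) t))

ren-id : ∀ {n} (t : Tm n) → ren id t ≡ t
ren-id t = trans (ren≡sub-var id t) (sub-id (λ _ → refl) t)

app-injectiveˡ : ∀ {n} {s s' u u' : Tm n} → app s u ≡ app s' u' → s ≡ s'
app-injectiveˡ refl = refl

app-injectiveʳ : ∀ {n} {s s' u u' : Tm n} → app s u ≡ app s' u' → u ≡ u'
app-injectiveʳ refl = refl

val-injective : ∀ {n} {v v' : Val n} → val v ≡ val v' → v ≡ v'
val-injective refl = refl

shift-injective : ∀ {n} {s s' : Tm (suc n)} → shift s ≡ shift s' → s ≡ s'
shift-injective refl = refl

reset-injective : ∀ {n} {s s' : Tm n} → reset s ≡ reset s' → s ≡ s'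
reset-injective refl = refl

infix 4 _↦_

data _↦_ {n : ℕ} : Tm n → Tm n → Set where
  βv    : ∀ t v → app (val (lam t)) (val v) ↦ t [ v ]
  shift : ∀ E t → reset (plugE E (shift t)) ↦ reset (t [ cont E ])
  reset : ∀ v → reset (val v) ↦ val v

plugF-↦ : ∀ {n} (F : FCtx n) {r c : Tm n} → r ↦ c → plugF F r ⟶ plugF F c
plugF-↦ F (βv t v)    = βv F t v
plugF-↦ F (shift E t) = shift F E t
plugF-↦ F (reset v)   = reset F v

⟶-decompose : ∀ {n} {t t' : Tm n} → t ⟶ t' →
  ∃[ F ] ∃[ r ] ∃[ c ] r ↦ c × t ≡ plugF F r × t' ≡ plugF F c
⟶-decompose (βv F t v)    = F , _ , _ , βv t v , refl , refl
⟶-decompose (shift F E t) = F , _ , _ , shift E t , refl , refl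
⟶-decompose (reset F v)   = F , _ , _ , reset v , refl , refl

plugE-shift≢val : ∀ {n} (E : ECtx n) {s : Tm (suc n)} {w : Val n} → plugE E (shift s) ≢ val w
plugE-shift≢val hole       ()
plugE-shift≢val (appR v E) ()
plugE-shift≢val (appL E t) ()

plugF-↦≢val : ∀ {n} (F : FCtx n) {r c : Tm n} {w : Val n} → r ↦ c → plugF F r ≢ val w
plugF-↦≢val hole (βv t v)    ()
plugF-↦≢val hole (shift E t) ()
plugF-↦≢val hole (reset v)   ()
plugF-↦≢val (appR v F) _ ()
plugF-↦≢val (appL F t) _ ()
plugF-↦≢val (reset F)  _ ()

plugE-shift≢plugF-↦ : ∀ {n} (E : ECtx n) (F : FCtx n) {s : Tm (suc n)} {r c : Tm n} →
                      r ↦ c → plugE E (shift s) ≢ plugF F r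
plugE-shift≢plugF-↦ hole hole (βv t v)    ()
plugE-shift≢plugF-↦ hole hole (shift E t) ()
plugE-shift≢plugF-↦ hole hole (reset v)   ()
plugE-shift≢plugF-↦ hole (appR v F) _ ()
plugE-shift≢plugF-↦ hole (appL F t) _ ()
plugE-shift≢plugF-↦ hole (reset F)  _ ()
plugE-shift≢plugF-↦ (appR v E) hole (βv t w)     eq = plugE-shift≢val E (app-injectiveʳ eq)
plugE-shift≢plugF-↦ (appR v E) hole (shift E' t) ()
plugE-shift≢plugF-↦ (appR v E) hole (reset w)    ()
plugE-shift≢plugF-↦ (appR v E) (appR w F) rc eq = plugE-shift≢plugF-↦ E F rc (app-injectiveʳ eq)
plugE-shift≢plugF-↦ (appR v E) (appL F t) rc eq = plugF-↦≢val F rc (sym (app-injectiveˡ eq))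
plugE-shift≢plugF-↦ (appR v E) (reset F)  _  ()
plugE-shift≢plugF-↦ (appL E u) hole (βv t w)     eq = plugE-shift≢val E (app-injectiveˡ eq)
plugE-shift≢plugF-↦ (appL E u) hole (shift E' t) ()
plugE-shift≢plugF-↦ (appL E u) hole (reset w)    ()
plugE-shift≢plugF-↦ (appL E u) (appR w F) rc eq = plugE-shift≢val E (app-injectiveˡ eq)
plugE-shift≢plugF-↦ (appL E u) (appL F t) rc eq = plugE-shift≢plugF-↦ E F rc (app-injectiveˡ eq)
plugE-shift≢plugF-↦ (appL E u) (reset F)  _  ()

plugE-shift-injective : ∀ {n} (E E' : ECtx n) {s s' : Tm (suc n)} →
                        plugE E (shift s) ≡ plugE E' (shift s') → E ≡ E' × s ≡ s'
plugE-shift-injective hole hole eq = refl , shift-injective eq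
plugE-shift-injective hole (appR v E') ()
plugE-shift-injective hole (appL E' t) ()
plugE-shift-injective (appR v E) hole ()
plugE-shift-injective (appL E t) hole ()
plugE-shift-injective (appR v E) (appR v' E') eq
  with plugE-shift-injective E E' (app-injectiveʳ eq)
... | E≡E' , s≡s' = cong₂ appR (val-injective (app-injectiveˡ eq)) E≡E' , s≡s'
plugE-shift-injective (appR v E) (appL E' t) eq =
  ⊥-elim (plugE-shift≢val E' (sym (app-injectiveˡ eq)))
plugE-shift-injective (appL E t) (appR v E') eq =
  ⊥-elim (plugE-shift≢val E (app-injectiveˡ eq))
plugE-shift-injective (appL E t) (appL E' t') eq
  with plugE-shift-injective E E' (app-injectiveˡ eq)
... | E≡E' , s≡s' = cong₂ appL E≡E' (app-injectiveʳ eq) , s≡s'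

↦-deterministic : ∀ {n} {r r' c c' : Tm n} → r ↦ c → r' ↦ c' → r ≡ r' → c ≡ c'
↦-deterministic (βv t v) (βv .t .v) refl = refl
↦-deterministic (shift E t) (shift E' t') eq
  with plugE-shift-injective E E' (reset-injective eq)
... | refl , refl = refl
↦-deterministic (shift E t) (reset v) eq = ⊥-elim (plugE-shift≢val E (reset-injective eq))
↦-deterministic (reset v) (shift E t) eq = ⊥-elim (plugE-shift≢val E (sym (reset-injective eq)))
↦-deterministic (reset v) (reset .v) refl = refl
↦-deterministic (βv t v)    (shift E t') ()
↦-deterministic (βv t v)    (reset w)    ()
↦-deterministic (shift E t) (βv t' v)    ()
↦-deterministic (reset v)   (βv t w)     ()

-- A redex has no proper subterm in evaluation position that is itself a redex.
↦-plugF-unique : ∀ {n} (G : FCtx n) {r r' c c' : Tm n} → r ↦ c → r' ↦ c' →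
                 r ≡ plugF G r' → c ≡ plugF G c'
↦-plugF-unique hole rc rc' eq = ↦-deterministic rc rc' eq
↦-plugF-unique (appR v G) (βv t w) rc' eq = ⊥-elim (plugF-↦≢val G rc' (sym (app-injectiveʳ eq)))
↦-plugF-unique (appL G u) (βv t w) rc' eq = ⊥-elim (plugF-↦≢val G rc' (sym (app-injectiveˡ eq)))
↦-plugF-unique (reset G) (shift E t) rc' eq = ⊥-elim (plugE-shift≢plugF-↦ E G rc' (reset-injective eq))
↦-plugF-unique (reset G) (reset w) rc' eq = ⊥-elim (plugF-↦≢val G rc' (sym (reset-injective eq)))
↦-plugF-unique (appR v G) (shift E t) rc' ()
↦-plugF-unique (appR v G) (reset w)   rc' ()
↦-plugF-unique (appL G u) (shift E t) rc' ()
↦-plugF-unique (appL G u) (reset w)   rc' ()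
↦-plugF-unique (reset G)  (βv t w)    rc' ()

plugF-↦-unique : ∀ {n} (F G : FCtx n) {r r' c c' : Tm n} → r ↦ c → r' ↦ c' →
                 plugF F r ≡ plugF G r' → plugF F c ≡ plugF G c'
plugF-↦-unique hole G rc rc' eq = ↦-plugF-unique G rc rc' eq
plugF-↦-unique F@(appR _ _) hole rc rc' eq = sym (↦-plugF-unique F rc' rc (sym eq))
plugF-↦-unique F@(appL _ _) hole rc rc' eq = sym (↦-plugF-unique F rc' rc (sym eq))
plugF-↦-unique F@(reset _)  hole rc rc' eq = sym (↦-plugF-unique F rc' rc (sym eq))
plugF-↦-unique (appR v F) (appR w G) rc rc' eq =
  cong₂ app (app-injectiveˡ eq) (plugF-↦-unique F G rc rc' (app-injectiveʳ eq))
plugF-↦-unique (appL F u) (appL G u') rc rc' eq =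
  cong₂ app (plugF-↦-unique F G rc rc' (app-injectiveˡ eq)) (app-injectiveʳ eq)
plugF-↦-unique (reset F) (reset G) rc rc' eq =
  cong reset (plugF-↦-unique F G rc rc' (reset-injective eq))
plugF-↦-unique (appR v F) (appL G u) rc rc' eq = ⊥-elim (plugF-↦≢val G rc' (sym (app-injectiveˡ eq)))
plugF-↦-unique (appL F u) (appR w G) rc rc' eq = ⊥-elim (plugF-↦≢val F rc (app-injectiveˡ eq))
plugF-↦-unique (appR v F) (reset G) rc rc' ()
plugF-↦-unique (appL F u) (reset G) rc rc' ()
plugF-↦-unique (reset F) (appR w G) rc rc' ()
plugF-↦-unique (reset F) (appL G u) rc rc' ()

⟶-deterministic : ∀ {n} → Deterministic _≡_ (_⟶_ {n})
⟶-deterministic t⟶t₁ t⟶t₂ with ⟶-decompose t⟶t₁ | ⟶-decompose t⟶t₂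
... | F , _ , _ , rc , refl , refl | G , _ , _ , rc' , t≡ , refl = plugF-↦-unique F G rc rc' t≡

value-irreducible : ∀ {n} {t : Tm n} → IsValue t → ¬ Reducible t
value-irreducible (w , refl) (_ , t⟶) with ⟶-decompose t⟶
... | F , _ , _ , rc , eq , _ = plugF-↦≢val F rc (sym eq)

stuck-irreducible : ∀ {n} {t : Tm n} → ControlStuck t → ¬ Reducible t
stuck-irreducible (E , s , refl) (_ , t⟶) with ⟶-decompose t⟶
... | F , _ , _ , rc , eq , _ = plugE-shift≢plugF-↦ E F rc eq

stuck⇒normal : ∀ {n} {t : Tm n} → ControlStuck t → NormalForm t
stuck⇒normal (E , s , refl) =
  inj₂ ((λ (_ , eq) → plugE-shift≢val E eq) , stuck-irreducible (E , s , refl))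

normal⇒irreducible : ∀ {n} {t : Tm n} → NormalForm t → ¬ Reducible t
normal⇒irreducible (inj₁ t-value)         = value-irreducible t-value
normal⇒irreducible (inj₂ (_ , irreducible)) = irreducible

⟶*-to-normal : ∀ {n} {x y z : Tm n} → x ⟶* y → x ⟶* z → NormalForm z → y ⟶* z
⟶*-to-normal x⟶*y x⟶*z z-normal with det⇒conf ⟶-deterministic x⟶*y x⟶*z
... | _ , y⟶*w , ε          = y⟶*w
... | _ , _    , (z⟶ ◅ _) = ⊥-elim (normal⇒irreducible z-normal (_ , z⟶))

EvalsTo : ∀ {n} → (Tm n → Set) → Tm n → Set
EvalsTo P t = ∃[ t' ] (t ⇓ t') × P t'

EvalsTo-⟶* : ∀ {n} {P : Tm n → Set} {x y : Tm n} → x ⟶* y → EvalsTo P x ⇔ EvalsTo P y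
EvalsTo-⟶* x⟶*y =
  mk⇔ (λ (z , (x⟶*z , z-normal) , Pz) → z , (⟶*-to-normal x⟶*y x⟶*z z-normal , z-normal) , Pz)
      (λ (z , (y⟶*z , z-normal) , Pz) → z , (x⟶*y ◅◅ y⟶*z , z-normal) , Pz)

ObsAgree-⟶* : ∀ {x y : Tm 0} → x ⟶* y → ObsAgree x y
ObsAgree-⟶* x⟶*y = EvalsTo-⟶* x⟶*y , EvalsTo-⟶* x⟶*y

ObsAgree-isEquivalence : IsEquivalence ObsAgree
ObsAgree-isEquivalence = record
  { refl  = ⇔.refl , ⇔.refl
  ; sym   = λ (p , q) → ⇔.sym p , ⇔.sym q
  ; trans = λ (p , q) (p' , q') → ⇔.trans p p' , ⇔.trans q q'
  }
  where module ⇔ = IsEquivalence (⇔-isEquivalence {ℓ = Level.zero})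

module ObsAgree = IsEquivalence ObsAgree-isEquivalence

_∘ᶜ_ : ∀ {j m k} → Ctx m k → Ctx j m → Ctx j k
hole     ∘ᶜ D = D
lam C    ∘ᶜ D = lam (C ∘ᶜ D)
appR t C ∘ᶜ D = appR t (C ∘ᶜ D)
appL C t ∘ᶜ D = appL (C ∘ᶜ D) t
shift C  ∘ᶜ D = shift (C ∘ᶜ D)
reset C  ∘ᶜ D = reset (C ∘ᶜ D)

plug-∘ᶜ : ∀ {j m k} (C : Ctx m k) (D : Ctx j m) (t : Tm j) → plug (C ∘ᶜ D) t ≡ plug C (plug D t)
plug-∘ᶜ hole       D t = refl
plug-∘ᶜ (lam C)    D t = cong (λ s → val (lam s)) (plug-∘ᶜ C D t)
plug-∘ᶜ (appR u C) D t = cong (app u) (plug-∘ᶜ C D t)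
plug-∘ᶜ (appL C u) D t = cong (λ s → app s u) (plug-∘ᶜ C D t)
plug-∘ᶜ (shift C)  D t = cong shift (plug-∘ᶜ C D t)
plug-∘ᶜ (reset C)  D t = cong reset (plug-∘ᶜ C D t)

≅-refl : ∀ {t : Tm 0} → t ≅ t
≅-refl C = ObsAgree.refl

≅-trans : ∀ {x y z : Tm 0} → x ≅ y → y ≅ z → x ≅ z
≅-trans x≅y y≅z C = ObsAgree.trans (x≅y C) (y≅z C)

≅-cong : ∀ (D : Ctx 0 0) {x x' : Tm 0} → x ≅ x' → plug D x ≅ plug D x'
≅-cong D {x} {x'} x≅x' C = subst₂ ObsAgree (plug-∘ᶜ C D x) (plug-∘ᶜ C D x') (x≅x' (C ∘ᶜ D))

≅°-sym : ∀ {n} {t₀ t₁ : Tm n} → t₀ ≅° t₁ → t₁ ≅° t₀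
≅°-sym t₀≅°t₁ σ C = ObsAgree.sym (t₀≅°t₁ σ C)

Ctx-scope-≤ : ∀ {m k} → Ctx m k → k ≤ m
Ctx-scope-≤ hole       = ≤-refl
Ctx-scope-≤ (lam C)    = ≤-trans (n≤1+n _) (Ctx-scope-≤ C)
Ctx-scope-≤ (appR t C) = Ctx-scope-≤ C
Ctx-scope-≤ (appL C t) = Ctx-scope-≤ C
Ctx-scope-≤ (shift C)  = ≤-trans (n≤1+n _) (Ctx-scope-≤ C)
Ctx-scope-≤ (reset C)  = Ctx-scope-≤ C

weaken : ∀ {n} → Tm 0 → Tm n
weaken = ren λ ()

weakenV : ∀ {n} → Val 0 → Val n
weakenV = renV λ ()

sub-weaken : ∀ {n} (σ : Sub n 0) (t : Tm 0) → sub σ (weaken t) ≡ t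
sub-weaken σ t = trans (sub-ren _ σ t) (sub-id (λ ()) t)

subV-weakenV : ∀ {n} (σ : Sub n 0) (v : Val 0) → subV σ (weakenV v) ≡ v
subV-weakenV σ v = trans (subV-renV _ σ v) (subV-id (λ ()) v)

weakenᶜ : ∀ {n} → Ctx 0 0 → Ctx n n
weakenᶜ hole       = hole
weakenᶜ (lam C)    = ⊥-elim (n≮0 (Ctx-scope-≤ C))
weakenᶜ (appR t C) = appR (weaken t) (weakenᶜ C)
weakenᶜ (appL C t) = appL (weakenᶜ C) (weaken t)
weakenᶜ (shift C)  = ⊥-elim (n≮0 (Ctx-scope-≤ C))
weakenᶜ (reset C)  = reset (weakenᶜ C)

sub-plug-weakenᶜ : ∀ {n} (σ : Sub n 0) (C : Ctx 0 0) (t : Tm n) →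
                   sub σ (plug (weakenᶜ C) t) ≡ plug C (sub σ t)
sub-plug-weakenᶜ σ hole       t = refl
sub-plug-weakenᶜ σ (lam C)    t = ⊥-elim (n≮0 (Ctx-scope-≤ C))
sub-plug-weakenᶜ σ (appR u C) t = cong₂ app (sub-weaken σ u) (sub-plug-weakenᶜ σ C t)
sub-plug-weakenᶜ σ (appL C u) t = cong₂ app (sub-plug-weakenᶜ σ C t) (sub-weaken σ u)
sub-plug-weakenᶜ σ (shift C)  t = ⊥-elim (n≮0 (Ctx-scope-≤ C))
sub-plug-weakenᶜ σ (reset C)  t = cong reset (sub-plug-weakenᶜ σ C t)

-- (λ.⋯((λ.□) (σ 0))⋯) (σ (n-1)): the innermost λ binds variable 0.
closing : ∀ {n} → Sub n 0 → Ctx n 0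
closing {zero}  σ = hole
closing {suc n} σ = closing (σ ∘ suc) ∘ᶜ appL (lam hole) (val (weakenV (σ zero)))

plug-closing-⟶* : ∀ {n} (σ : Sub n 0) (t : Tm n) → plug (closing σ) t ⟶* sub σ t
plug-closing-⟶* {zero}  σ t = subst (t ⟶*_) (sym (sub-id (λ ()) t)) ε
plug-closing-⟶* {suc n} σ t =
  subst (_⟶* sub σ t) (sym (plug-∘ᶜ (closing σ') _ t))
    (plug-closing-⟶* σ' (app (val (lam t)) (val w)) ◅◅
     subst (sub σ' (app (val (lam t)) (val w)) ⟶_) contractum (βv hole _ _) ◅ ε)
  where
  σ' : Sub n 0
  σ' = σ ∘ suc
  w : Val n
  w = weakenV (σ zero)
  single-extS : subV (single (subV σ' w)) ∘ extS σ' ≗ σ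
  single-extS zero    = subV-weakenV σ' (σ zero)
  single-extS (suc i) = trans (subV-renV suc _ (σ' i)) (subV-id (λ _ → refl) (σ' i))
  contractum : sub (extS σ') t [ subV σ' w ] ≡ sub σ t
  contractum = trans (sub-sub (extS σ') _ t) (sub-cong single-extS t)

closing-ObsAgree⇒≅° : ∀ {n} (t₀ t₁ : Tm n) →
  ((C : Ctx n 0) → ObsAgree (plug C t₀) (plug C t₁)) → t₀ ≅° t₁
closing-ObsAgree⇒≅° t₀ t₁ agree σ C =
  ObsAgree.trans (ObsAgree.sym (closes t₀)) (ObsAgree.trans (agree D) (closes t₁))
  where
  D : Ctx _ 0
  D = closing σ ∘ᶜ weakenᶜ C
  closes : ∀ t → ObsAgree (plug D t) (plug C (sub σ t))
  closes t = subst₂ ObsAgree (sym (plug-∘ᶜ (closing σ) (weakenᶜ C) t)) (sub-plug-weakenᶜ σ C t)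
               (ObsAgree-⟶* (plug-closing-⟶* σ (plug (weakenᶜ C) t)))

module Simulation {n : ℕ} (a b : Tm n) (a≅°b : a ≅° b) where

  infix 4 _~_ _~ᵛ_ _~ᴱ_

  mutual
    data _~_ {k : ℕ} : Tm k → Tm k → Set where
      val   : ∀ {v v'} → v ~ᵛ v' → val v ~ val v'
      app   : ∀ {s s' u u'} → s ~ s' → u ~ u' → app s u ~ app s' u'
      shift : ∀ {s s'} → s ~ s' → shift s ~ shift s'
      reset : ∀ {s s'} → s ~ s' → reset s ~ reset s'
      inst  : ∀ {τ τ' : Sub n k} → (∀ i → τ i ~ᵛ τ' i) → sub τ a ~ sub τ' b

    data _~ᵛ_ {k : ℕ} : Val k → Val k → Set where
      var : ∀ {i} → var i ~ᵛ var i
      lam : ∀ {s s'} → s ~ s' → lam s ~ᵛ lam s'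

  mutual
    ~-refl : ∀ {k} (t : Tm k) → t ~ t
    ~-refl (val v)   = val (~ᵛ-refl v)
    ~-refl (app t u) = app (~-refl t) (~-refl u)
    ~-refl (shift t) = shift (~-refl t)
    ~-refl (reset t) = reset (~-refl t)

    ~ᵛ-refl : ∀ {k} (v : Val k) → v ~ᵛ v
    ~ᵛ-refl (var i) = var
    ~ᵛ-refl (lam t) = lam (~-refl t)

  mutual
    ~-ren : ∀ {k j} {s s' : Tm k} (ρ : Ren k j) → s ~ s' → ren ρ s ~ ren ρ s'
    ~-ren ρ (val p)   = val (~ᵛ-renV ρ p)
    ~-ren ρ (app p q) = app (~-ren ρ p) (~-ren ρ q)
    ~-ren ρ (shift p) = shift (~-ren (extR ρ) p)
    ~-ren ρ (reset p) = reset (~-ren ρ p)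
    ~-ren ρ (inst {τ} {τ'} τ~τ') =
      subst₂ _~_ (sym (ren-sub τ ρ a)) (sym (ren-sub τ' ρ b)) (inst (~ᵛ-renV ρ ∘ τ~τ'))

    ~ᵛ-renV : ∀ {k j} {v v' : Val k} (ρ : Ren k j) → v ~ᵛ v' → renV ρ v ~ᵛ renV ρ v'
    ~ᵛ-renV ρ var     = var
    ~ᵛ-renV ρ (lam p) = lam (~-ren (extR ρ) p)

  ~ᵛ-extS : ∀ {k j} {σ σ' : Sub k j} → (∀ i → σ i ~ᵛ σ' i) → ∀ i → extS σ i ~ᵛ extS σ' i
  ~ᵛ-extS σ~σ' zero    = var
  ~ᵛ-extS σ~σ' (suc i) = ~ᵛ-renV suc (σ~σ' i)

  mutual
    ~-sub : ∀ {k j} {s s' : Tm k} {σ σ' : Sub k j} →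
            (∀ i → σ i ~ᵛ σ' i) → s ~ s' → sub σ s ~ sub σ' s'
    ~-sub σ~σ' (val p)   = val (~ᵛ-subV σ~σ' p)
    ~-sub σ~σ' (app p q) = app (~-sub σ~σ' p) (~-sub σ~σ' q)
    ~-sub σ~σ' (shift p) = shift (~-sub (~ᵛ-extS σ~σ') p)
    ~-sub σ~σ' (reset p) = reset (~-sub σ~σ' p)
    ~-sub {σ = σ} {σ'} σ~σ' (inst {τ} {τ'} τ~τ') =
      subst₂ _~_ (sym (sub-sub τ σ a)) (sym (sub-sub τ' σ' b)) (inst (~ᵛ-subV σ~σ' ∘ τ~τ'))

    ~ᵛ-subV : ∀ {k j} {v v' : Val k} {σ σ' : Sub k j} →
              (∀ i → σ i ~ᵛ σ' i) → v ~ᵛ v' → subV σ v ~ᵛ subV σ' v'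
    ~ᵛ-subV σ~σ' (var {i}) = σ~σ' i
    ~ᵛ-subV σ~σ' (lam p)   = lam (~-sub (~ᵛ-extS σ~σ') p)

  ~-[] : ∀ {k} {s s' : Tm (suc k)} {v v' : Val k} → s ~ s' → v ~ᵛ v' → s [ v ] ~ s' [ v' ]
  ~-[] s~s' v~v' = ~-sub single~single s~s'
    where
    single~single : ∀ i → single _ i ~ᵛ single _ i
    single~single zero    = v~v'
    single~single (suc i) = var

  data _~ᴱ_ {k : ℕ} : ECtx k → ECtx k → Set where
    hole : hole ~ᴱ hole
    appR : ∀ {v v' E E'} → v ~ᵛ v' → E ~ᴱ E' → appR v E ~ᴱ appR v' E'
    appL : ∀ {E E' t t'} → E ~ᴱ E' → t ~ t' → appL E t ~ᴱ appL E' t'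

  ~-plugE : ∀ {k} {E E' : ECtx k} {s s'} → E ~ᴱ E' → s ~ s' → plugE E s ~ plugE E' s'
  ~-plugE hole       s~s' = s~s'
  ~-plugE (appR p e) s~s' = app (val p) (~-plugE e s~s')
  ~-plugE (appL e p) s~s' = app (~-plugE e s~s') p

  ~ᴱ-renE : ∀ {k j} {E E' : ECtx k} (ρ : Ren k j) → E ~ᴱ E' → renE ρ E ~ᴱ renE ρ E'
  ~ᴱ-renE ρ hole       = hole
  ~ᴱ-renE ρ (appR p e) = appR (~ᵛ-renV ρ p) (~ᴱ-renE ρ e)
  ~ᴱ-renE ρ (appL e p) = appL (~ᴱ-renE ρ e) (~-ren ρ p)

  ~ᵛ-cont : ∀ {k} {E E' : ECtx k} → E ~ᴱ E' → cont E ~ᵛ cont E'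
  ~ᵛ-cont e = lam (reset (~-plugE (~ᴱ-renE suc e) (val var)))

  ~-plug : ∀ {m k} (C : Ctx m k) {s s' : Tm m} → s ~ s' → plug C s ~ plug C s'
  ~-plug hole       p = p
  ~-plug (lam C)    p = val (lam (~-plug C p))
  ~-plug (appR t C) p = app (~-refl t) (~-plug C p)
  ~-plug (appL C t) p = app (~-plug C p) (~-refl t)
  ~-plug (shift C)  p = shift (~-plug C p)
  ~-plug (reset C)  p = reset (~-plug C p)

  ~-plug-ren : ∀ {m} (ρ : Ren n m) (C : Ctx m 0) → plug C (ren ρ a) ~ plug C (ren ρ b)
  ~-plug-ren ρ C =
    ~-plug C (subst₂ _~_ (sym (ren≡sub-var ρ a)) (sym (ren≡sub-var ρ b)) (inst (λ _ → var)))

  data Shallow : Tm 0 → Tm 0 → Set where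
    val   : ∀ {v v'} → v ~ᵛ v' → Shallow (val v) (val v')
    app   : ∀ {s s' u u'} → Shallow s s' → Shallow u u' → Shallow (app s u) (app s' u')
    shift : ∀ {s s'} → s ~ s' → Shallow (shift s) (shift s')
    reset : ∀ {s s'} → Shallow s s' → Shallow (reset s) (reset s')

  Shallow⇒~ : ∀ {s s'} → Shallow s s' → s ~ s'
  Shallow⇒~ (val p)   = val p
  Shallow⇒~ (app p q) = app (Shallow⇒~ p) (Shallow⇒~ q)
  Shallow⇒~ (shift p) = shift p
  Shallow⇒~ (reset p) = reset (Shallow⇒~ p)

  Shallow-sub : ∀ {j} {τ τ' : Sub j 0} → (∀ i → τ i ~ᵛ τ' i) → (u : Tm j) →
                Shallow (sub τ u) (sub τ' u)
  Shallow-sub τ~τ' (val (var i)) = val (τ~τ' i)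
  Shallow-sub τ~τ' (val (lam u)) = val (lam (~-sub (~ᵛ-extS τ~τ') (~-refl u)))
  Shallow-sub τ~τ' (app u w)     = app (Shallow-sub τ~τ' u) (Shallow-sub τ~τ' w)
  Shallow-sub τ~τ' (shift u)     = shift (~-sub (~ᵛ-extS τ~τ') (~-refl u))
  Shallow-sub τ~τ' (reset u)     = reset (Shallow-sub τ~τ' u)

  ~⇒Shallow-≅ : ∀ {s s' : Tm 0} → s ~ s' → ∃[ s'' ] Shallow s s'' × s'' ≅ s'
  ~⇒Shallow-≅ (val {v' = v'} p) = val v' , val p , ≅-refl
  ~⇒Shallow-≅ (app p q) with ~⇒Shallow-≅ p | ~⇒Shallow-≅ q
  ... | x , x-sh , x≅ | y , y-sh , y≅ =
    app x y , app x-sh y-sh , ≅-trans (≅-cong (appL hole y) x≅) (≅-cong (appR _ hole) y≅)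
  ~⇒Shallow-≅ (shift {s' = s'} p) = shift s' , shift p , ≅-refl
  ~⇒Shallow-≅ (reset p) with ~⇒Shallow-≅ p
  ... | x , x-sh , x≅ = reset x , reset x-sh , ≅-cong (reset hole) x≅
  ~⇒Shallow-≅ (inst {τ' = τ'} τ~τ') = sub τ' a , Shallow-sub τ~τ' a , a≅°b τ'

  Shallow-plugE-shift : ∀ (E : ECtx 0) {t : Tm 1} {x : Tm 0} → Shallow (plugE E (shift t)) x →
    ∃[ E' ] ∃[ t' ] x ≡ plugE E' (shift t') × E ~ᴱ E' × t ~ t'
  Shallow-plugE-shift hole (shift p) = hole , _ , refl , hole , p
  Shallow-plugE-shift (appR v E) (app (val q) p) with Shallow-plugE-shift E p
  ... | E' , t' , refl , e , r = appR _ E' , t' , refl , appR q e , r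
  Shallow-plugE-shift (appL E u) (app p q) with Shallow-plugE-shift E p
  ... | E' , t' , refl , e , r = appL E' _ , t' , refl , appL e (Shallow⇒~ q) , r

  Shallow-↦ : ∀ {r c r' : Tm 0} → r ↦ c → Shallow r r' → ∃[ c' ] r' ↦ c' × c ~ c'
  Shallow-↦ (βv t v) (app (val (lam p)) (val q)) = _ , βv _ _ , ~-[] p q
  Shallow-↦ (shift E t) (reset q) with Shallow-plugE-shift E q
  ... | E' , t' , refl , e , p = _ , shift E' t' , reset (~-[] p (~ᵛ-cont e))
  Shallow-↦ (reset v) (reset (val q)) = _ , reset _ , val q

  Shallow-plugF-↦ : ∀ (F : FCtx 0) {r c s' : Tm 0} → r ↦ c → Shallow (plugF F r) s' →
    ∃[ F' ] ∃[ r' ] ∃[ c' ] s' ≡ plugF F' r' × r' ↦ c' × plugF F c ~ plugF F' c'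
  Shallow-plugF-↦ hole rc p with Shallow-↦ rc p
  ... | c' , rc' , q = hole , _ , c' , refl , rc' , q
  Shallow-plugF-↦ (appR v F) rc (app (val q) p) with Shallow-plugF-↦ F rc p
  ... | F' , r' , c' , refl , rc' , z = appR _ F' , r' , c' , refl , rc' , app (val q) z
  Shallow-plugF-↦ (appL F t) rc (app p q) with Shallow-plugF-↦ F rc p
  ... | F' , r' , c' , refl , rc' , z = appL F' _ , r' , c' , refl , rc' , app z (Shallow⇒~ q)
  Shallow-plugF-↦ (reset F) rc (reset p) with Shallow-plugF-↦ F rc p
  ... | F' , r' , c' , refl , rc' , z = reset F' , r' , c' , refl , rc' , reset z

  Shallow-⟶ : ∀ {s s' s₁ : Tm 0} → Shallow s s' → s ⟶ s₁ → ∃[ s₁' ] s' ⟶ s₁' × s₁ ~ s₁'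
  Shallow-⟶ p s⟶s₁ with ⟶-decompose s⟶s₁
  ... | F , r , c , rc , refl , refl with Shallow-plugF-↦ F rc p
  ... | F' , r' , c' , refl , rc' , z = _ , plugF-↦ F' rc' , z

  Shallow-value : ∀ {s s'} → Shallow s s' → IsValue s → IsValue s'
  Shallow-value (val {v' = v'} _) _ = v' , refl

  Shallow-stuck : ∀ {s s'} → Shallow s s' → ControlStuck s → ControlStuck s'
  Shallow-stuck p (E , t , refl) with Shallow-plugE-shift E p
  ... | E' , t' , refl , _ = E' , t' , refl

  module _ {P : Tm 0 → Set}
           (P⇒normal : ∀ {t} → P t → NormalForm t)
           (Shallow-P : ∀ {s s'} → Shallow s s' → P s → P s')
           (ObsAgree⇒EvalsTo : ∀ {s s'} → ObsAgree s s' → EvalsTo P s ⇔ EvalsTo P s')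
    where

    ~-EvalsTo : ∀ {s s' t : Tm 0} → s ~ s' → s ⟶* t → P t → EvalsTo P s'
    ~-EvalsTo s~s' s⟶*t Pt with ~⇒Shallow-≅ s~s'
    ~-EvalsTo s~s' ε Pt | s'' , sh , s''≅s' =
      Equivalence.to (ObsAgree⇒EvalsTo (s''≅s' hole))
        (s'' , (ε , P⇒normal (Shallow-P sh Pt)) , Shallow-P sh Pt)
    ~-EvalsTo s~s' (s⟶ ◅ s₁⟶*t) Pt | s'' , sh , s''≅s' with Shallow-⟶ sh s⟶
    ... | _ , s''⟶ , s₁~ with ~-EvalsTo s₁~ s₁⟶*t Pt
    ... | z , (⟶*z , z-normal) , Pz =
      Equivalence.to (ObsAgree⇒EvalsTo (s''≅s' hole)) (z , (s''⟶ ◅ ⟶*z , z-normal) , Pz)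

  ~-EvalsToValue : ∀ {s s' : Tm 0} → s ~ s' → EvalsToValue s → EvalsToValue s'
  ~-EvalsToValue s~s' (_ , (s⟶*t , _) , t-value) =
    ~-EvalsTo inj₁ Shallow-value proj₁ s~s' s⟶*t t-value

  ~-EvalsToStuck : ∀ {s s' : Tm 0} → s ~ s' → EvalsToStuck s → EvalsToStuck s'
  ~-EvalsToStuck s~s' (_ , (s⟶*t , _) , t-stuck) =
    ~-EvalsTo stuck⇒normal Shallow-stuck proj₂ s~s' s⟶*t t-stuck

≅°⇒ObsAgree-plug-ren : ∀ {n m} {t₀ t₁ : Tm n} → t₀ ≅° t₁ → (ρ : Ren n m) (C : Ctx m 0) →
                        ObsAgree (plug C (ren ρ t₀)) (plug C (ren ρ t₁))
≅°⇒ObsAgree-plug-ren t₀≅°t₁ ρ C =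
  mk⇔ (S₀₁.~-EvalsToValue (S₀₁.~-plug-ren ρ C)) (S₁₀.~-EvalsToValue (S₁₀.~-plug-ren ρ C)) ,
  mk⇔ (S₀₁.~-EvalsToStuck (S₀₁.~-plug-ren ρ C)) (S₁₀.~-EvalsToStuck (S₁₀.~-plug-ren ρ C))
  where
  module S₀₁ = Simulation _ _ t₀≅°t₁
  module S₁₀ = Simulation _ _ (≅°-sym t₀≅°t₁)

proposition4p18 : ∀ {n} (t₀ t₁ : Tm n) →
    (t₀ ≅° t₁) ⇔
    ((m : ℕ) (ρ : Fin n → Fin m) → InjOnFV ρ t₀ t₁ → (C : Ctx m 0) →
       ObsAgree (plug C (ren ρ t₀)) (plug C (ren ρ t₁)))
proposition4p18 t₀ t₁ = mk⇔
  (λ t₀≅°t₁ m ρ _ → ≅°⇒ObsAgree-plug-ren t₀≅°t₁ ρ)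
  (λ agree → closing-ObsAgree⇒≅° t₀ t₁ λ C →
     subst₂ (λ x y → ObsAgree (plug C x) (plug C y)) (ren-id t₀) (ren-id t₁)
       (agree _ id (λ _ _ _ _ → id) C))
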